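{- Let $\Pi$ be a ground program with atom set $\mathcal{A}$, $A\subseteq\mathcal{A}$, and suppose $\hat I$ is a concrete answer set of $\mathit{omit}(\Pi,A)$. Then for every $A'\subseteq A$ there exists an answer set $\hat I'\in AS(\mathit{omit}(\Pi,A'))$ such that $\hat I'|_{\overline{A}}=\hat I$.
   Context: Ground programs consist of rules $\alpha_0 \leftarrow \alpha_1,\dots,\alpha_m,\mathit{not}\ \alpha_{m+1},\dots,\mathit{not}\ \alpha_n$ with $\alpha_0$ an atom or $\bot$ (constraint), possibly with choice rules $\{\alpha\}\leftarrow B$ (abbreviating $\alpha\leftarrow B,\mathit{not}\ \bar\alpha$ and $\bar\alpha\leftarrow B,\mathit{not}\ \alpha$ with fresh $\bar\alpha$, projected away from answer sets). $H(r)$, $B^+(r)$, $B^-(r)$, $B^\pm(r)=B^+(r)\cup B^-(r)$, $B(r)$ denote head, positive body, negative body, all body atoms, and body. $I$ is an answer set of $\Pi$ iff $I$ is a $\subseteq$-minimal model of $\{r\in\Pi\mid I\models B(r)\}$; $AS(\Pi)$ is the set of answer sets. For $A\subseteq\mathcal{A}$, $\mathit{omit}(r,A)$ is $r$ if $A\cap B^\pm(r)=\emptyset$ and $H(r)\notin A$; is $\{H(r)\}\leftarrow B^+(r)\setminus A,\mathit{not}\ (B^-(r)\setminus A)$ if $A\cap B^\pm(r)\neq\emptyset$ and $H(r)\notin A\cup\{\bot\}$; and is no rule otherwise (choice rules treated analogously: kept, body-projected keeping the choice head, or dropped). $\mathit{omit}(\Pi,A)=\bigcup_{r\in\Pi}\mathit{omit}(r,A)$.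 $\overline{A}=\mathcal{A}\setminus A$, $I|_{\overline{A}}=I\cap\overline{A}$. An answer set $\hat I$ of $\mathit{omit}(\Pi,A)$ is concrete if $\hat I=I|_{\overline{A}}$ for some $I\in AS(\Pi)$, and spurious otherwise. -}

module Defs where

open import Data.Bool using (Bool; true; false; _∧_; _∨_; not; if_then_else_)
open import Data.Fin using (Fin)
open import Data.List using (List; []; _∷_; _++_; concatMap; map)
open import Data.List.Membership.Propositional using (_∈_)
open import Data.List.Relation.Unary.All using (All)
open import Data.Maybe using (Maybe; just; nothing)
open import Data.Product using (Σ; _×_; _,_)
open import Data.Sum using (_⊎_; inj₁; inj₂)
open import Data.Empty using (⊥)
open import Data.Unit using (⊤)
open import Relation.Binary.PropositionalEquality using (_≡_)
open import Relation.Nullary using (¬_)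

-- Interpretations / subsets of an atom set X are Boolean-valued predicates.
Interp : Set → Set
Interp X = X → Bool

_⊆_ : {X : Set} → Interp X → Interp X → Set
_⊆_ {X} I J = (x : X) → I x ≡ true → J x ≡ true

restrict : {X : Set} → Interp X → Interp X → Interp X
restrict I A x = I x ∧ not (A x)

data Head (X : Set) : Set where
  atom   : X → Head X
  bot    : Head X
  choice : X → Head X

record Rule (X : Set) : Set where
  constructor _⇐_,not_
  field
    head : Head X
    pos  : List X
    neg  : List X
open Rule public

Program : Set → Set
Program X = List (Rule X)

-- Normal rules (no choice heads); head nothing = ⊥

record NRule (Y : Set) : Set where
  constructor nrule
  field
    nhead : Maybe Y
    npos  : List Y
    nneg  : List Y
open NRule public

SatBody : {Y : Set} → Interp Y → List Y → List Y → Set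
SatBody I ps ns = All (λ a → I a ≡ true) ps × All (λ a → I a ≡ false) ns

HeadTrue : {Y : Set} → Interp Y → Maybe Y → Set
HeadTrue I (just a) = I a ≡ true
HeadTrue I nothing  = ⊥

ModelOfReduct : {Y : Set} → Interp Y → List (NRule Y) → Interp Y → Set
ModelOfReduct I P J =
  ∀ r → r ∈ P → SatBody I (npos r) (nneg r) →
  SatBody J (npos r) (nneg r) → HeadTrue J (nhead r)

IsAnswerSetN : {Y : Set} → List (NRule Y) → Interp Y → Set
IsAnswerSetN P I =
  ModelOfReduct I P I × (∀ J → J ⊆ I → ModelOfReduct I P J → I ⊆ J)

-- Choice rules as abbreviations: {α} ← B  stands for
--   α ← B, not ᾱ    and    ᾱ ← B, not α
-- where ᾱ = inj₂ α is a fresh atom (original atoms are inj₁ α).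

translate : {X : Set} → Rule X → List (NRule (X ⊎ X))
translate (atom a ⇐ ps ,not ns) =
  nrule (just (inj₁ a)) (map inj₁ ps) (map inj₁ ns) ∷ []
translate (bot ⇐ ps ,not ns) =
  nrule nothing (map inj₁ ps) (map inj₁ ns) ∷ []
translate (choice a ⇐ ps ,not ns) =
  nrule (just (inj₁ a)) (map inj₁ ps) (map inj₁ ns ++ (inj₂ a ∷ [])) ∷
  nrule (just (inj₂ a)) (map inj₁ ps) (map inj₁ ns ++ (inj₁ a ∷ [])) ∷ []

-- Answer sets of a program (fresh atoms projected away)
IsAnswerSet : {X : Set} → Program X → Interp X → Set
IsAnswerSet {X} Π I =
  Σ (Interp (X ⊎ X)) λ J →
    IsAnswerSetN (concatMap translate Π) J × ((x : X) → I x ≡ J (inj₁ x))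

headIn : {X : Set} → Interp X → Head X → Bool
headIn A (atom a)   = A a
headIn A bot        = false
headIn A (choice a) = A a

anyIn : {X : Set} → Interp X → List X → Bool
anyIn A []       = false
anyIn A (x ∷ xs) = A x ∨ anyIn A xs

minus : {X : Set} → List X → Interp X → List X
minus []       A = []
minus (x ∷ xs) A = if A x then minus xs A else x ∷ minus xs A

omitRule : {X : Set} → Interp X → Rule X → List (Rule X)
omitRule A (h ⇐ ps ,not ns) with anyIn A (ps ++ ns) | h
... | false | h'       = if headIn A h' then [] else ((h' ⇐ ps ,not ns) ∷ [])
... | true  | bot      = []
... | true  | atom a   = if A a then [] else
                           ((choice a ⇐ minus ps A
                                     ,not minus ns A) ∷ [])
... | true  | choice a = if A a then [] else
                           ((choice a ⇐ minus ps A
                                     ,not minus ns A) ∷ [])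

omit : {X : Set} → Program X → Interp X → Program X
omit Π A = concatMap (omitRule A) Π

IsConcrete : {X : Set} → Program X → Interp X → Interp X → Set
IsConcrete {X} Π A Î =
  IsAnswerSet (omit Π A) Î ×
  Σ (Interp X) λ I → IsAnswerSet Π I × ((x : X) → restrict I A x ≡ Î x)

-- The proof rests on one general fact, `omit-answer-set`: omitting atoms
-- over-approximates, i.e. for ANY answer set I of Π and ANY A', the
-- restriction I|_{\overline{A'}} is an answer set of omit(Π, A').  Its
-- witness on the translated program (choice rules unfolded with bar atoms)
-- keeps the original atoms of I outside A' and switches the bar atom ā on
-- exactly when a is off and some choice rule {a} ← B of omit(Π, A') fires.
-- Modelhood is checked rule by rule, using that every rule of omit(Π, A') is
-- a choice rule or an untouched rule of Π avoiding A'.  Minimality lifts a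
-- smaller model K back to the translation of Π (taking J on A' and on bar
-- atoms), where minimality of I forces it to contain I.
-- The theorem then follows because restricting to \overline{A'} and then to
-- \overline{A} is restricting to \overline{A} when A' ⊆ A.
module Submission where

open import Defs
open import Data.Nat using (ℕ)
open import Data.Fin using (Fin)
import Data.Fin as Fin
open import Data.Bool using (true; false; _∧_; not; if_then_else_)
import Data.Bool as Bool
open import Data.Bool.Properties using (∧-zeroʳ; ∧-identityʳ)
open import Data.List using (List; []; _∷_; _++_; concatMap; map)
open import Data.List.Membership.Propositional using (_∈_; find; lose)
open import Data.List.Membership.Propositional.Properties using (∈-concatMap⁺; ∈-concatMap⁻)
open import Data.List.Relation.Unary.Any using (here; there; any?)
open import Data.List.Relation.Unary.All using (All; []; _∷_; all?)
import Data.List.Relation.Unary.All as All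
open import Data.List.Relation.Unary.All.Properties using (map⁺; map⁻; ++⁺; ++⁻; ++⁻ˡ)
open import Data.Maybe using (just)
open import Data.Product using (Σ; ∃; _×_; _,_; proj₁; proj₂)
open import Data.Sum using (_⊎_; inj₁; inj₂)
open import Data.Empty using (⊥)
open import Function using (_∘_)
open import Relation.Binary.Definitions using (DecidableEquality)
open import Relation.Binary.PropositionalEquality using (_≡_; refl; sym; trans; cong)
open import Relation.Nullary using (Dec; yes; no; does; _×-dec_)
open import Relation.Nullary.Decidable using (dec-true)

∈-concatMap-intro : ∀ {A B : Set} (f : A → List B) {xs x y} →
  x ∈ xs → y ∈ f x → y ∈ concatMap f xs
∈-concatMap-intro f x∈xs y∈fx = ∈-concatMap⁺ f (lose x∈xs y∈fx)

∈-concatMap-elim : ∀ {A B : Set} (f : A → List B) {xs y} →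
  y ∈ concatMap f xs → ∃ λ x → x ∈ xs × y ∈ f x
∈-concatMap-elim f y∈ = find (∈-concatMap⁻ f y∈)

restrict-restrict : ∀ {X : Set} (I A' A : Interp X) → A' ⊆ A →
  ∀ x → restrict (restrict I A') A x ≡ restrict I A x
restrict-restrict I A' A A'⊆A x with A x in Ax | A' x in A'x
... | true  | _     = trans (∧-zeroʳ _) (sym (∧-zeroʳ _))
... | false | true  with () ← trans (sym (A'⊆A x A'x)) Ax
... | false | false = cong (_∧ true) (∧-identityʳ (I x))

module _ {X : Set} where

  agree-sat : {A' f g : Interp X} → (∀ x → A' x ≡ false → f x ≡ g x) →
    ∀ {ps ns} → All (λ x → A' x ≡ false) ps → All (λ x → A' x ≡ false) ns →
    SatBody f ps ns → SatBody g ps ns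
  agree-sat {A'} {f} {g} agree offp offn (sp , sn) = move offp sp , move offn sn
    where
    move : ∀ {b xs} → All (λ x → A' x ≡ false) xs → All (λ x → f x ≡ b) xs →
      All (λ x → g x ≡ b) xs
    move off s = All.zipWith (λ (o , e) → trans (sym (agree _ o)) e) (off , s)

  inj₁-sat⁺ : {L : Interp (X ⊎ X)} {ps ns : List X} →
    SatBody (L ∘ inj₁) ps ns → SatBody L (map inj₁ ps) (map inj₁ ns)
  inj₁-sat⁺ (sp , sn) = map⁺ sp , map⁺ sn

  inj₁-sat⁻ : {L : Interp (X ⊎ X)} {ps ns : List X} →
    SatBody L (map inj₁ ps) (map inj₁ ns) → SatBody (L ∘ inj₁) ps ns
  inj₁-sat⁻ (sp , sn) = map⁻ sp , map⁻ sn

  data HeadAtom : Head X → X → Set where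
    atomHead   : ∀ {a} → HeadAtom (atom a) a
    choiceHead : ∀ {a} → HeadAtom (choice a) a

  guarded : ∀ {h a} → HeadAtom h a → List (X ⊎ X) → List (X ⊎ X)
  guarded atomHead   ns = ns
  guarded {a = a} choiceHead ns = ns ++ inj₂ a ∷ []

  derivingRule : ∀ {h a} → HeadAtom h a → List X → List X → NRule (X ⊎ X)
  derivingRule {a = a} p ps ns = nrule (just (inj₁ a)) (map inj₁ ps) (guarded p (map inj₁ ns))

  derivingRule-∈ : ∀ {h a} (p : HeadAtom h a) {ps ns} →
    derivingRule p ps ns ∈ translate (h ⇐ ps ,not ns)
  derivingRule-∈ atomHead   = here refl
  derivingRule-∈ choiceHead = here refl

  derivingRule-sat : ∀ {h a} (p : HeadAtom h a) {L : Interp (X ⊎ X)} {ps ns} →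
    L (inj₂ a) ≡ false → SatBody (L ∘ inj₁) ps ns →
    SatBody L (npos (derivingRule p ps ns)) (nneg (derivingRule p ps ns))
  derivingRule-sat atomHead   ā-off s         = inj₁-sat⁺ s
  derivingRule-sat choiceHead ā-off (sp , sn) = map⁺ sp , ++⁺ (map⁺ sn) (ā-off ∷ [])

  derivingRule-body : ∀ {h a} (p : HeadAtom h a) {L : Interp (X ⊎ X)} {ps ns} →
    SatBody L (npos (derivingRule p ps ns)) (nneg (derivingRule p ps ns)) →
    SatBody (L ∘ inj₁) ps ns
  derivingRule-body atomHead             s         = inj₁-sat⁻ s
  derivingRule-body choiceHead {ns = ns} (sp , sn) = map⁻ sp , map⁻ (++⁻ˡ (map inj₁ ns) sn)

  headIn-atom : ∀ {A : Interp X} {h a} → HeadAtom h a → headIn A h ≡ A a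
  headIn-atom atomHead   = refl
  headIn-atom choiceHead = refl

module _ {X : Set} (A : Interp X) where

  anyIn-false : ∀ xs → anyIn A xs ≡ false → All (λ x → A x ≡ false) xs
  anyIn-false []       _ = []
  anyIn-false (x ∷ xs) e with A x in Ax
  ... | false = Ax ∷ anyIn-false xs e

  minus-avoids : ∀ xs → All (λ x → A x ≡ false) (minus xs A)
  minus-avoids []       = []
  minus-avoids (x ∷ xs) with A x in Ax
  ... | true  = minus-avoids xs
  ... | false = Ax ∷ minus-avoids xs

  minus-all : ∀ {P : X → Set} {xs} → All P xs → All P (minus xs A)
  minus-all [] = []
  minus-all {xs = x ∷ _} (px ∷ pxs) with A x
  ... | true  = minus-all pxs
  ... | false = px ∷ minus-all pxs

  minus-sat : ∀ {I : Interp X} {ps ns} → SatBody I ps ns → SatBody I (minus ps A) (minus ns A)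
  minus-sat (sp , sn) = minus-all sp , minus-all sn

  data IsChoice : Head X → Set where
    isChoice : ∀ {a} → IsChoice (choice a)

  Avoids : Rule X → Set
  Avoids r = anyIn A (pos r ++ neg r) ≡ false × headIn A (head r) ≡ false

  omitRule-shape : ∀ r q → q ∈ omitRule A r → IsChoice (head q) ⊎ (q ≡ r × Avoids r)
  omitRule-shape (h ⇐ ps ,not ns) q q∈ with anyIn A (ps ++ ns) | h
  ... | false | h' with headIn A h'
  omitRule-shape _ q (here refl) | false | h' | false = inj₂ (refl , refl , refl)
  omitRule-shape _ q () | false | h' | true
  omitRule-shape _ q () | true | bot
  omitRule-shape _ q q∈ | true | atom a with A a
  omitRule-shape _ q () | true | atom a | true
  omitRule-shape _ q (here refl) | true | atom a | false = inj₁ isChoice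
  omitRule-shape _ q q∈ | true | choice a with A a
  omitRule-shape _ q () | true | choice a | true
  omitRule-shape _ q (here refl) | true | choice a | false = inj₁ isChoice

  omitRule-keeps : ∀ {h ps ns} → anyIn A (ps ++ ns) ≡ false → headIn A h ≡ false →
    (h ⇐ ps ,not ns) ∈ omitRule A (h ⇐ ps ,not ns)
  omitRule-keeps {h} {ps} {ns} hit hd with anyIn A (ps ++ ns) | h
  ... | true  | _  with () ← hit
  ... | false | h' rewrite hd = here refl

  omitRule-projects : ∀ {h a ps ns} → HeadAtom h a → anyIn A (ps ++ ns) ≡ true → A a ≡ false →
    (choice a ⇐ minus ps A ,not minus ns A) ∈ omitRule A (h ⇐ ps ,not ns)
  omitRule-projects atomHead   hit Aa rewrite hit | Aa = here refl
  omitRule-projects choiceHead hit Aa rewrite hit | Aa = here refl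

module Projection {X : Set} (_≟_ : DecidableEquality X) (Π : Program X) (A' : Interp X)
  (J : Interp (X ⊎ X)) (J-as : IsAnswerSetN (concatMap translate Π) J) where

  Off : X → Set
  Off x = A' x ≡ false

  Ω : Program X
  Ω = omit Π A'

  J-closed : ∀ {r₀ r} → r₀ ∈ Π → r ∈ translate r₀ →
    SatBody J (npos r) (nneg r) → HeadTrue J (nhead r)
  J-closed r₀∈ r∈ s = proj₁ J-as _ (∈-concatMap-intro translate r₀∈ r∈) s s

  I' : Interp X
  I' = restrict (J ∘ inj₁) A'

  I'-off : ∀ {x} → Off x → I' x ≡ J (inj₁ x)
  I'-off {x} off rewrite off = ∧-identityʳ _

  I'-on : ∀ {x} → I' x ≡ true → J (inj₁ x) ≡ true × Off x
  I'-on {x} e with J (inj₁ x) | A' x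
  I'-on refl | true | false = refl , refl

  Fires : X → Rule X → Set
  Fires a (choice b ⇐ ps ,not ns) = a ≡ b × SatBody I' ps ns
  Fires a (atom _   ⇐ _ ,not _)   = ⊥
  Fires a (bot      ⇐ _ ,not _)   = ⊥

  fires? : ∀ a q → Dec (Fires a q)
  fires? a (choice b ⇐ ps ,not ns) =
    a ≟ b ×-dec all? (λ x → I' x Bool.≟ true) ps ×-dec all? (λ x → I' x Bool.≟ false) ns
  fires? a (atom _ ⇐ _ ,not _) = no λ ()
  fires? a (bot    ⇐ _ ,not _) = no λ ()

  J' : Interp (X ⊎ X)
  J' (inj₁ x) = I' x
  J' (inj₂ a) = not (I' a) ∧ does (any? (fires? a) Ω)

  bar-off : ∀ {a} → I' a ≡ true → J' (inj₂ a) ≡ false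
  bar-off a-on rewrite a-on = refl

  bar-on : ∀ {a ps ns} → I' a ≡ false → (choice a ⇐ ps ,not ns) ∈ Ω → SatBody I' ps ns →
    J' (inj₂ a) ≡ true
  bar-on {a} a-off q∈ s rewrite a-off | dec-true (any? (fires? a) Ω) (lose q∈ (refl , s)) = refl

  fired-atom-on : ∀ {a ps ns} → J' (inj₂ a) ≡ false → (choice a ⇐ ps ,not ns) ∈ Ω →
    SatBody I' ps ns → I' a ≡ true
  fired-atom-on {a} ā-off q∈ s with I' a | dec-true (any? (fires? a) Ω) (lose q∈ (refl , s))
  ... | true  | _    = refl
  ... | false | sup with () ← trans (sym sup) ā-off

  bar-support : ∀ {a} → J' (inj₂ a) ≡ true →
    I' a ≡ false × ∃ λ ps → ∃ λ ns → (choice a ⇐ ps ,not ns) ∈ Ω × SatBody I' ps ns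
  bar-support {a} ā-on with I' a | any? (fires? a) Ω
  bar-support ()   | true  | _
  bar-support ()   | false | no _
  bar-support ā-on | false | yes sup with find sup
  ... | choice _ ⇐ ps ,not ns , q∈ , refl , s = refl , ps , ns , q∈ , s
  ... | atom _   ⇐ _ ,not _ , _ , ()
  ... | bot      ⇐ _ ,not _ , _ , ()

  choice-closed : ∀ {a ps ns r} → (choice a ⇐ ps ,not ns) ∈ Ω →
    r ∈ translate (choice a ⇐ ps ,not ns) → SatBody J' (npos r) (nneg r) → HeadTrue J' (nhead r)
  choice-closed {ns = ns} q∈ (here refl) (sp , sn) =
    let sn' , ā-off = ++⁻ (map inj₁ ns) sn
    in fired-atom-on (All.head ā-off) q∈ (map⁻ sp , map⁻ sn')
  choice-closed {ns = ns} q∈ (there (here refl)) (sp , sn) =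
    let sn' , a-off = ++⁻ (map inj₁ ns) sn
    in bar-on (All.head a-off) q∈ (map⁻ sp , map⁻ sn')

  J'-to-J : ∀ {ps ns} → anyIn A' (ps ++ ns) ≡ false →
    SatBody J' (map inj₁ ps) (map inj₁ ns) → SatBody J (map inj₁ ps) (map inj₁ ns)
  J'-to-J {ps} hit s =
    let offp , offn = ++⁻ ps (anyIn-false A' _ hit)
    in inj₁-sat⁺ (agree-sat (λ _ → I'-off) offp offn (inj₁-sat⁻ s))

  -- J' is closed under each rule of omit(Π, A'): choice rules by the choice
  -- of bar atoms, kept rules of Π because J is closed under them.
  J'-closed : ∀ {r₀ q r} → r₀ ∈ Π → q ∈ omitRule A' r₀ → r ∈ translate q →
    SatBody J' (npos r) (nneg r) → HeadTrue J' (nhead r)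
  J'-closed {q = choice _ ⇐ _ ,not _} r₀∈ q∈ r∈ =
    choice-closed (∈-concatMap-intro (omitRule A') r₀∈ q∈) r∈
  J'-closed {r₀} {q = atom _ ⇐ _ ,not _} r₀∈ q∈ (here refl) s with omitRule-shape A' r₀ _ q∈
  ... | inj₂ (refl , hit , hd) = trans (I'-off hd) (J-closed r₀∈ (here refl) (J'-to-J hit s))
  J'-closed {r₀} {q = bot ⇐ _ ,not _} r₀∈ q∈ (here refl) s with omitRule-shape A' r₀ _ q∈
  ... | inj₂ (refl , hit , hd) = J-closed r₀∈ (here refl) (J'-to-J hit s)

  J'-model : ModelOfReduct J' (concatMap translate Ω) J'
  J'-model r r∈ s _ with ∈-concatMap-elim translate r∈
  ... | q , q∈Ω , r∈q with ∈-concatMap-elim (omitRule A') q∈Ω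
  ... | r₀ , r₀∈ , q∈ = J'-closed r₀∈ q∈ r∈q s

  module Minimality (K : Interp (X ⊎ X)) (K⊆J' : K ⊆ J')
    (K-model : ModelOfReduct J' (concatMap translate Ω) K) where

    K-off : ∀ {y} → J' y ≡ false → K y ≡ false
    K-off {y} e with K y in Ky
    ... | false = refl
    ... | true with () ← trans (sym (K⊆J' y Ky)) e

    K-closed : ∀ {q r} → q ∈ Ω → r ∈ translate q →
      SatBody J' (npos r) (nneg r) → SatBody K (npos r) (nneg r) → HeadTrue K (nhead r)
    K-closed q∈ r∈ = K-model _ (∈-concatMap-intro translate q∈ r∈)

    K* : Interp (X ⊎ X)
    K* (inj₁ x) = if A' x then J (inj₁ x) else K (inj₁ x)
    K* (inj₂ a) = J (inj₂ a)

    K*-off : ∀ {x} → Off x → K* (inj₁ x) ≡ K (inj₁ x)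
    K*-off off rewrite off = refl

    K*⊆J : K* ⊆ J
    K*⊆J (inj₁ x) e with A' x
    ... | true  = e
    ... | false = proj₁ (I'-on (K⊆J' (inj₁ x) e))
    K*⊆J (inj₂ a) e = e

    derive-in-K : ∀ {h a ps ns} (p : HeadAtom h a) → (h ⇐ ps ,not ns) ∈ Ω →
      All Off ps → All Off ns → I' a ≡ true →
      SatBody (J ∘ inj₁) ps ns → SatBody (K* ∘ inj₁) ps ns → K (inj₁ a) ≡ true
    derive-in-K p q∈ offp offn a-on sJ sK* =
      K-closed q∈ (derivingRule-∈ p)
        (derivingRule-sat p (bar-off a-on) (agree-sat (λ _ o → sym (I'-off o)) offp offn sJ))
        (derivingRule-sat p (K-off (bar-off a-on)) (agree-sat (λ _ → K*-off) offp offn sK*))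

    K*-derives : ∀ {h a ps ns} (p : HeadAtom h a) → (h ⇐ ps ,not ns) ∈ Π →
      SatBody (J ∘ inj₁) ps ns → SatBody (K* ∘ inj₁) ps ns → J (inj₁ a) ≡ true →
      K* (inj₁ a) ≡ true
    K*-derives {a = a} {ps} {ns} p r₀∈ sJ sK* Ja with A' a in A'a
    ... | true = Ja
    ... | false with anyIn A' (ps ++ ns) in hit
    ... | false =
      let offp , offn = ++⁻ ps (anyIn-false A' _ hit)
          kept = omitRule-keeps A' hit (trans (headIn-atom p) A'a)
      in derive-in-K p (∈-concatMap-intro (omitRule A') r₀∈ kept)
           offp offn (trans (I'-off A'a) Ja) sJ sK*
    ... | true =
      let projected = omitRule-projects A' {ps = ps} {ns} p hit A'a
      in derive-in-K choiceHead (∈-concatMap-intro (omitRule A') r₀∈ projected)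
           (minus-avoids A' ps) (minus-avoids A' ns) (trans (I'-off A'a) Ja)
           (minus-sat A' sJ) (minus-sat A' sK*)

    K*-closed : ∀ {r₀ r} → r₀ ∈ Π → r ∈ translate r₀ →
      SatBody J (npos r) (nneg r) → SatBody K* (npos r) (nneg r) → HeadTrue K* (nhead r)
    K*-closed {atom _ ⇐ ps ,not ns} r₀∈ (here refl) sJ sK* =
      K*-derives atomHead r₀∈ (inj₁-sat⁻ {ps = ps} {ns} sJ) (inj₁-sat⁻ {ps = ps} {ns} sK*)
        (J-closed r₀∈ (here refl) sJ)
    K*-closed {choice _ ⇐ _ ,not _} r₀∈ (here refl) sJ sK* =
      K*-derives choiceHead r₀∈ (derivingRule-body choiceHead sJ) (derivingRule-body choiceHead sK*)
        (J-closed r₀∈ (here refl) sJ)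
    K*-closed {choice _ ⇐ _ ,not _} r₀∈ (there (here refl)) sJ _ = J-closed r₀∈ (there (here refl)) sJ
    K*-closed {bot ⇐ _ ,not _} r₀∈ (here refl) sJ _ = J-closed r₀∈ (here refl) sJ

    K*-model : ModelOfReduct J (concatMap translate Π) K*
    K*-model r r∈ sJ sK* with ∈-concatMap-elim translate r∈
    ... | r₀ , r₀∈ , r∈r₀ = K*-closed r₀∈ r∈r₀ sJ sK*

    -- Minimality of J makes K contain I'.
    I'⊆K : ∀ x → I' x ≡ true → K (inj₁ x) ≡ true
    I'⊆K x x-on =
      let Jx , off = I'-on x-on
      in trans (sym (K*-off off)) (proj₂ J-as K* K*⊆J K*-model (inj₁ x) Jx)

    J'⊆K : J' ⊆ K
    J'⊆K (inj₁ x) x-on = I'⊆K x x-on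
    J'⊆K (inj₂ a) ā-on with bar-support ā-on
    ... | a-off , ps , ns , q∈ , sp , sn =
      K-closed q∈ (there (here refl))
        (map⁺ sp , ++⁺ (map⁺ sn) (a-off ∷ []))
        (map⁺ (All.map (I'⊆K _) sp) , ++⁺ (map⁺ (All.map (K-off {inj₁ _}) sn)) (K-off a-off ∷ []))

  J'-answer-set : IsAnswerSetN (concatMap translate Ω) J'
  J'-answer-set = J'-model , λ K K⊆J' K-model → Minimality.J'⊆K K K⊆J' K-model

omit-answer-set : ∀ {X : Set} → DecidableEquality X → (Π : Program X) (A' : Interp X)
  {I : Interp X} → IsAnswerSet Π I → IsAnswerSet (omit Π A') (restrict I A')
omit-answer-set _≟_ Π A' (J , J-as , I≡J) =
  J' , J'-answer-set , λ x → cong (λ b → b ∧ not (A' x)) (I≡J x)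
  where open Projection _≟_ Π A' J J-as

proposition6 : (n : ℕ) (Π : Program (Fin n)) (A : Interp (Fin n)) (Î : Interp (Fin n)) →
    IsConcrete Π A Î →
    (A' : Interp (Fin n)) → A' ⊆ A →
    Σ (Interp (Fin n)) λ Î' →
    IsAnswerSet (omit Π A') Î' × ((x : Fin n) → restrict Î' A x ≡ Î x)
proposition6 n Π A Î (_ , I , I-answer-set , I-abstracts-to-Î) A' A'⊆A =
  restrict I A' ,
  omit-answer-set Fin._≟_ Π A' I-answer-set ,
  λ x → trans (restrict-restrict I A' A A'⊆A x) (I-abstracts-to-Î x)
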